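{- Let $G=(V,E)$ be a finite tree (undirected) with parameters $\vartheta_w\in[0,1]$ for $w\in V$, and consider the linear threshold model with slackness on $G$. For every $v\in V$, $\sigma(\{v\})\le\deg(v)+1$.
   Context: Linear threshold model with slackness on an undirected graph $G=(V,E)$ with parameters $(\vartheta_w)_{w\in V}$: each undirected edge $\{x,y\}$ is regarded as the two directed edges $(x,y),(y,x)$. Independently for each vertex $w$ with $\deg(w)>0$: with probability $1-\vartheta_w$, $w$ selects no live incoming edge; with probability $\vartheta_w$, $w$ selects exactly one of its $\deg(w)$ incoming directed edges uniformly at random as "live". Vertices of degree $0$ select nothing. Given a seed set $S$, the infected vertices are those reachable from $S$ by directed paths of live edges (including $S$ itself), and $\sigma(S)$ is the expected number of infected vertices.
   Formalization: The parameters $\vartheta_w$ are rational numbers in [0,1]. -}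

module Defs where

open import Data.Nat using (ℕ; zero; suc; _≤_)
open import Data.Bool using (Bool; true; false; if_then_else_; _∨_)
open import Data.Fin using (Fin; _≟_)
open import Data.List using (List; []; _∷_; [_]; _++_; map; foldr; length; allFin; concatMap)
open import Data.List.Relation.Unary.Unique.Propositional using (Unique)
open import Data.List.Relation.Unary.Linked using (Linked)
open import Data.Maybe using (Maybe; nothing; just)
open import Data.Vec using (Vec; lookup) renaming ([] to []ᵥ; _∷_ to _∷ᵥ_)
open import Data.Integer using (+_)
open import Data.Rational using (ℚ; 0ℚ; 1ℚ; _+_; _*_; _-_; _/_)
open import Data.Product using (Σ; _×_)
open import Relation.Nullary using (¬_)
open import Relation.Nullary.Decidable using (⌊_⌋)
open import Relation.Binary.PropositionalEquality using (_≡_)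

record Graph (n : ℕ) : Set where
  field
    adj    : Fin n → Fin n → Bool
    sym    : ∀ x y → adj x y ≡ adj y x
    irrefl : ∀ x → adj x x ≡ false
open Graph public

module _ {n : ℕ} (G : Graph n) where

  Adj : Fin n → Fin n → Set
  Adj x y = adj G x y ≡ true

  data Walk : Fin n → Fin n → Set where
    here : ∀ {x} → Walk x x
    step : ∀ {x y z} → Adj x y → Walk y z → Walk x z

  Connected : Set
  Connected = ∀ x y → Walk x y

  IsCycle : List (Fin n) → Set
  IsCycle [] = Data.Empty.⊥
    where import Data.Empty
  IsCycle (x ∷ ys) = (3 ≤ length (x ∷ ys)) × Unique (x ∷ ys) × Linked Adj ((x ∷ ys) ++ [ x ])

  Acyclic : Set
  Acyclic = ∀ xs → ¬ IsCycle xs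

  IsTree : Set
  IsTree = Connected × Acyclic

  deg : Fin n → ℕ
  deg w = foldr Data.Nat._+_ 0 (map (λ u → if adj G w u then 1 else 0) (allFin n))

  -- Linear threshold model with slackness.
  -- Each vertex w makes a choice in Maybe (Fin n): 'nothing' = no live
  -- incoming edge; 'just u' = the directed edge (u , w) is live.
  choiceProb : (ϑ : Fin n → ℚ) → (w : Fin n) → Maybe (Fin n) → ℚ
  choiceProb ϑ w c = go (deg w) c
    where
    go : ℕ → Maybe (Fin n) → ℚ
    go zero    nothing  = 1ℚ
    go zero    (just u) = 0ℚ
    go (suc k) nothing  = 1ℚ - ϑ w
    go (suc k) (just u) = if adj G u w then ϑ w * (+ 1 / suc k) else 0ℚ

  Config : Set
  Config = Vec (Maybe (Fin n)) n

  allVecs : {A : Set} → List A → (k : ℕ) → List (Vec A k)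
  allVecs xs zero    = [ []ᵥ ]
  allVecs xs (suc k) = concatMap (λ x → map (x ∷ᵥ_) (allVecs xs k)) xs

  allConfigs : List Config
  allConfigs = allVecs (nothing ∷ map just (allFin n)) n

  configProb : (ϑ : Fin n → ℚ) → Config → ℚ
  configProb ϑ c = foldr _*_ 1ℚ (map (λ w → choiceProb ϑ w (lookup c w)) (allFin n))

  spread : Config → (Fin n → Bool) → (Fin n → Bool)
  spread c I u with lookup c u
  ... | nothing = I u
  ... | just x  = I u ∨ I x

  iter : ℕ → Config → (Fin n → Bool) → (Fin n → Bool)
  iter zero    c I = I
  iter (suc k) c I = spread c (iter k c I)

  -- vertices reachable from S by directed live-edge paths
  -- (paths have length < n, so n rounds of closure suffice)
  infected : Config → (Fin n → Bool) → (Fin n → Bool)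
  infected c S = iter n c S

  countTrue : (Fin n → Bool) → ℕ
  countTrue I = foldr Data.Nat._+_ 0 (map (λ u → if I u then 1 else 0) (allFin n))

  σ : (ϑ : Fin n → ℚ) → (S : Fin n → Bool) → ℚ
  σ ϑ S = foldr _+_ 0ℚ (map (λ c → configProb ϑ c * (+ countTrue (infected c S) / 1)) allConfigs)

  singleton : Fin n → (Fin n → Bool)
  singleton v u = ⌊ u ≟ v ⌋

{-# OPTIONS --safe #-}
-- Every vertex keeps at most one live in-edge, so each vertex infected from v is
-- the endpoint of a live path from v without repeated vertices, and
-- σ({v}) ≤ 1 + E[N] where N counts these paths of positive length.  The live
-- in-edge of u is independent of the part of a path before u: a path ending in l
-- is extended to a fresh neighbour u with probability ϑ_u / deg u, and from u at
-- most deg u − 1 neighbours are still fresh.  By induction on the length, the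
-- expected number of paths leaving l through fresh neighbours is at most the
-- number of those neighbours, which is deg v at the root.
module Submission where

open import Defs renaming (sym to adj-sym)

-- A module of its own keeps the ℚ-valued _+_ opened here apart from the
-- ℕ-valued _+_ of the statement.
module _ where
  open import Algebra using (CommutativeMonoid)
  open import Data.Bool using (Bool; true; false; _∨_; _∧_; not; if_then_else_)
  open import Data.Bool.Properties using (∧-zeroʳ; ∧-identityʳ; ∨-identityʳ)
  open import Data.Empty using (⊥-elim)
  open import Data.Fin using (Fin; zero; suc; _≟_)
  open import Data.Integer as ℤ using ()
  import Data.Integer.Properties as ℤ
  open import Data.List using (List; []; _∷_; map; foldr; _++_; concatMap; allFin)
  open import Data.Bool.ListAction using (any)
  open import Data.List.Membership.Propositional using (_∈_)
  open import Data.List.Membership.Propositional.Properties using (∈-allFin)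
  open import Data.List.Properties using (map-tabulate)
  open import Data.List.Relation.Unary.Any using (here; there)
  open import Data.Maybe using (Maybe; just; nothing)
  open import Data.Nat as ℕ using (ℕ; zero; suc; z≤n; s≤s)
  import Data.Nat.Properties as ℕ
  open import Data.Product using (Σ-syntax; _,_; _×_; proj₁; proj₂)
  open import Data.Rational using (ℚ; 0ℚ; 1ℚ; _≤_; _+_; _*_; -_; _-_; _/_; toℚᵘ; nonNegative)
  open import Data.Rational.Properties hiding (_≟_)
  import Data.Rational.Unnormalised as ℚᵘ
  import Data.Rational.Unnormalised.Properties as ℚᵘ
  open import Data.Sum using (_⊎_; inj₁; inj₂)
  open import Data.Vec using (Vec; lookup; _[_]≔_) renaming ([] to []ᵥ; _∷_ to _∷ᵥ_)
  open import Data.Vec.Properties using (lookup∘update′)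
  open import Function using (_∘_; id)
  open import Relation.Binary.PropositionalEquality
  open import Relation.Nullary.Decidable using (⌊_⌋; yes; no)

  import Algebra.Properties.CommutativeSemigroup as CommSemigroupProperties
  open CommSemigroupProperties (CommutativeMonoid.commutativeSemigroup +-0-commutativeMonoid)
    using () renaming (interchange to +-interchange)
  open CommSemigroupProperties (CommutativeMonoid.commutativeSemigroup *-1-commutativeMonoid)
    using () renaming (x∙yz≈y∙xz to *-leftSwap)
  open import Algebra.Properties.Group +-0-group using () renaming (//-rightDividesˡ to p-q+q≡p)
  open CommSemigroupProperties ℕ.+-commutativeSemigroup
    using () renaming (interchange to ℕ-+-interchange)

  fromℕ : ℕ → ℚ
  fromℕ m = ℤ.+ m / 1

  toℚᵘ-fromℕ : ∀ m → toℚᵘ (fromℕ m) ℚᵘ.≃ ℚᵘ.mkℚᵘ (ℤ.+ m) 0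
  toℚᵘ-fromℕ m = toℚᵘ-fromℚᵘ (ℚᵘ.mkℚᵘ (ℤ.+ m) 0)

  fromℕ-+ : ∀ a b → fromℕ (a ℕ.+ b) ≡ fromℕ a + fromℕ b
  fromℕ-+ a b = toℚᵘ-injective (begin
    toℚᵘ (fromℕ (a ℕ.+ b))                     ≈⟨ toℚᵘ-fromℕ (a ℕ.+ b) ⟩
    ℚᵘ.mkℚᵘ (ℤ.+ (a ℕ.+ b)) 0                  ≈⟨ ℚᵘ.*≡* (cong (ℤ._* ℤ.+ 1) numerators) ⟨
    ℚᵘ.mkℚᵘ (ℤ.+ a) 0 ℚᵘ.+ ℚᵘ.mkℚᵘ (ℤ.+ b) 0   ≈⟨ ℚᵘ.+-cong (toℚᵘ-fromℕ a) (toℚᵘ-fromℕ b) ⟨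
    toℚᵘ (fromℕ a) ℚᵘ.+ toℚᵘ (fromℕ b)         ≈⟨ toℚᵘ-homo-+ (fromℕ a) (fromℕ b) ⟨
    toℚᵘ (fromℕ a + fromℕ b)                   ∎)
    where
    open ℚᵘ.≃-Reasoning
    numerators : (ℤ.+ a) ℤ.* (ℤ.+ 1) ℤ.+ (ℤ.+ b) ℤ.* (ℤ.+ 1) ≡ ℤ.+ (a ℕ.+ b)
    numerators = cong₂ ℤ._+_ (ℤ.*-identityʳ (ℤ.+ a)) (ℤ.*-identityʳ (ℤ.+ b))

  fromℕ-suc : ∀ a → fromℕ (suc a) ≡ 1ℚ + fromℕ a
  fromℕ-suc = fromℕ-+ 1

  fromℕ-if : ∀ b m → fromℕ (if b then m else 0) ≡ (if b then 1ℚ else 0ℚ) * fromℕ m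
  fromℕ-if true  m = sym (*-identityˡ (fromℕ m))
  fromℕ-if false m = sym (*-zeroˡ (fromℕ m))

  fromℕ-nonNeg : ∀ a → 0ℚ ≤ fromℕ a
  fromℕ-nonNeg a = nonNegative⁻¹ (fromℕ a) {{normalize-nonNeg a 1}}

  fromℕ-mono-≤ : ∀ {a b} → a ℕ.≤ b → fromℕ a ≤ fromℕ b
  fromℕ-mono-≤ {a} {b} a≤b = begin
    fromℕ a                     ≡⟨ +-identityʳ (fromℕ a) ⟨
    fromℕ a + 0ℚ                ≤⟨ +-monoʳ-≤ (fromℕ a) (fromℕ-nonNeg (b ℕ.∸ a)) ⟩
    fromℕ a + fromℕ (b ℕ.∸ a)   ≡⟨ fromℕ-+ a (b ℕ.∸ a) ⟨
    fromℕ (a ℕ.+ (b ℕ.∸ a))     ≡⟨ cong fromℕ (ℕ.m+[n∸m]≡n a≤b) ⟩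
    fromℕ b                     ∎
    where open ≤-Reasoning

  1/n*n≡1 : ∀ d → (ℤ.+ 1 / suc d) * fromℕ (suc d) ≡ 1ℚ
  1/n*n≡1 d = toℚᵘ-injective (begin
    toℚᵘ ((ℤ.+ 1 / suc d) * fromℕ (suc d))
      ≈⟨ toℚᵘ-homo-* (ℤ.+ 1 / suc d) (fromℕ (suc d)) ⟩
    toℚᵘ (ℤ.+ 1 / suc d) ℚᵘ.* toℚᵘ (fromℕ (suc d))
      ≈⟨ ℚᵘ.*-cong (toℚᵘ-fromℚᵘ (ℚᵘ.mkℚᵘ (ℤ.+ 1) d)) (toℚᵘ-fromℕ (suc d)) ⟩
    ℚᵘ.mkℚᵘ (ℤ.+ 1) d ℚᵘ.* ℚᵘ.mkℚᵘ (ℤ.+ suc d) 0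
      ≈⟨ ℚᵘ.*≡* cross-multiplied ⟩
    ℚᵘ.1ℚᵘ ∎)
    where
    open ℚᵘ.≃-Reasoning
    cross-multiplied : ℤ.1ℤ ℤ.* ℤ.+ suc d ℤ.* ℤ.+ 1 ≡ ℤ.1ℤ ℤ.* ℤ.+ (suc d ℕ.* 1)
    cross-multiplied = trans (ℤ.*-identityʳ _) (trans (ℤ.*-identityˡ (ℤ.+ suc d))
                         (sym (trans (ℤ.*-identityˡ _) (cong ℤ.+_ (ℕ.*-identityʳ (suc d))))))

  p≡0⇒p*q≤1 : ∀ {p} q → p ≡ 0ℚ → p * q ≤ 1ℚ
  p≡0⇒p*q≤1 q refl = ≤-trans (≤-reflexive (*-zeroˡ q)) (nonNegative⁻¹ 1ℚ)

  Σℚ : {A : Set} → List A → (A → ℚ) → ℚ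
  Σℚ xs f = foldr _+_ 0ℚ (map f xs)

  module _ {A : Set} where

    Σℚ-cong : (xs : List A) {f g : A → ℚ} → (∀ x → f x ≡ g x) → Σℚ xs f ≡ Σℚ xs g
    Σℚ-cong []       f≗g = refl
    Σℚ-cong (x ∷ xs) f≗g = cong₂ _+_ (f≗g x) (Σℚ-cong xs f≗g)

    Σℚ-mono-≤ : (xs : List A) {f g : A → ℚ} → (∀ x → f x ≤ g x) → Σℚ xs f ≤ Σℚ xs g
    Σℚ-mono-≤ []       f≤g = ≤-refl
    Σℚ-mono-≤ (x ∷ xs) f≤g = +-mono-≤ (f≤g x) (Σℚ-mono-≤ xs f≤g)

    Σℚ-0 : (xs : List A) → Σℚ xs (λ _ → 0ℚ) ≡ 0ℚ
    Σℚ-0 []       = refl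
    Σℚ-0 (x ∷ xs) = trans (+-identityˡ _) (Σℚ-0 xs)

    Σℚ-+ : (xs : List A) (f g : A → ℚ) → Σℚ xs (λ x → f x + g x) ≡ Σℚ xs f + Σℚ xs g
    Σℚ-+ []       f g = refl
    Σℚ-+ (x ∷ xs) f g =
      trans (cong ((f x + g x) +_) (Σℚ-+ xs f g)) (+-interchange (f x) (g x) (Σℚ xs f) (Σℚ xs g))

    Σℚ-*ˡ : (xs : List A) (a : ℚ) (f : A → ℚ) → Σℚ xs (λ x → a * f x) ≡ a * Σℚ xs f
    Σℚ-*ˡ []       a f = sym (*-zeroʳ a)
    Σℚ-*ˡ (x ∷ xs) a f = trans (cong (a * f x +_) (Σℚ-*ˡ xs a f)) (sym (*-distribˡ-+ a (f x) (Σℚ xs f)))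

    Σℚ-*ʳ : (xs : List A) (a : ℚ) (f : A → ℚ) → Σℚ xs (λ x → f x * a) ≡ Σℚ xs f * a
    Σℚ-*ʳ xs a f = trans (Σℚ-cong xs (λ x → *-comm (f x) a)) (trans (Σℚ-*ˡ xs a f) (*-comm a _))

    Σℚ-++ : (xs ys : List A) (f : A → ℚ) → Σℚ (xs ++ ys) f ≡ Σℚ xs f + Σℚ ys f
    Σℚ-++ []       ys f = sym (+-identityˡ _)
    Σℚ-++ (x ∷ xs) ys f = trans (cong (f x +_) (Σℚ-++ xs ys f)) (sym (+-assoc (f x) _ _))

    Σℚ-map : {B : Set} (xs : List B) (g : B → A) (f : A → ℚ) → Σℚ (map g xs) f ≡ Σℚ xs (f ∘ g)
    Σℚ-map []       g f = refl
    Σℚ-map (x ∷ xs) g f = cong (f (g x) +_) (Σℚ-map xs g f)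

    Σℚ-concatMap : {B : Set} (xs : List B) (g : B → List A) (f : A → ℚ) →
                   Σℚ (concatMap g xs) f ≡ Σℚ xs (λ x → Σℚ (g x) f)
    Σℚ-concatMap []       g f = refl
    Σℚ-concatMap (x ∷ xs) g f =
      trans (Σℚ-++ (g x) (concatMap g xs) f) (cong (Σℚ (g x) f +_) (Σℚ-concatMap xs g f))

  map-allFin-suc : ∀ {B : Set} k (f : Fin (suc k) → B) → map f (allFin (suc k)) ≡ f zero ∷ map (f ∘ suc) (allFin k)
  map-allFin-suc k f = cong (f zero ∷_) (trans (map-tabulate suc f) (sym (map-tabulate id (f ∘ suc))))

  ∨-introˡ : ∀ {a} b → a ≡ true → a ∨ b ≡ true
  ∨-introˡ b refl = refl

  ∨-introʳ : ∀ a {b} → b ≡ true → a ∨ b ≡ true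
  ∨-introʳ true  b≡true = refl
  ∨-introʳ false b≡true = b≡true

  ∨-elim : ∀ a {b} → a ∨ b ≡ true → a ≡ true ⊎ b ≡ true
  ∨-elim true  _        = inj₁ refl
  ∨-elim false b≡true   = inj₂ b≡true

  ∧-intro : ∀ {a b} → a ≡ true → b ≡ true → a ∧ b ≡ true
  ∧-intro refl refl = refl

  ∧-elimˡ : ∀ a {b} → a ∧ b ≡ true → a ≡ true
  ∧-elimˡ true _ = refl

  ∧-elimʳ : ∀ a {b} → a ∧ b ≡ true → b ≡ true
  ∧-elimʳ true b≡true = b≡true

  ≟-sound : ∀ {m} (x y : Fin m) → ⌊ x ≟ y ⌋ ≡ true → x ≡ y
  ≟-sound x y x≟y with x ≟ y
  ... | yes x≡y = x≡y

  ≟-refl : ∀ {m} (x : Fin m) → ⌊ x ≟ x ⌋ ≡ true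
  ≟-refl x with x ≟ x
  ... | yes _   = refl
  ... | no x≢x  = ⊥-elim (x≢x refl)

  Σℕ : {A : Set} → List A → (A → ℕ) → ℕ
  Σℕ xs f = foldr ℕ._+_ 0 (map f xs)

  𝟙 : Bool → ℕ
  𝟙 b = if b then 1 else 0

  count : {A : Set} → List A → (A → Bool) → ℕ
  count xs p = Σℕ xs (𝟙 ∘ p)

  𝟙-mono-≤ : ∀ a b → (a ≡ true → b ≡ true) → 𝟙 a ℕ.≤ 𝟙 b
  𝟙-mono-≤ false b a⇒b = z≤n
  𝟙-mono-≤ true  b a⇒b rewrite a⇒b refl = ℕ.≤-refl

  𝟙-∨ : ∀ a b → 𝟙 (a ∨ b) ℕ.≤ 𝟙 a ℕ.+ 𝟙 b
  𝟙-∨ true  b = ℕ.m≤m+n 1 (𝟙 b)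
  𝟙-∨ false b = ℕ.≤-refl

  module _ {A : Set} where

    Σℕ-cong : (xs : List A) {f g : A → ℕ} → (∀ x → f x ≡ g x) → Σℕ xs f ≡ Σℕ xs g
    Σℕ-cong []       f≗g = refl
    Σℕ-cong (x ∷ xs) f≗g = cong₂ ℕ._+_ (f≗g x) (Σℕ-cong xs f≗g)

    Σℕ-mono-≤ : (xs : List A) {f g : A → ℕ} → (∀ x → f x ℕ.≤ g x) → Σℕ xs f ℕ.≤ Σℕ xs g
    Σℕ-mono-≤ []       f≤g = z≤n
    Σℕ-mono-≤ (x ∷ xs) f≤g = ℕ.+-mono-≤ (f≤g x) (Σℕ-mono-≤ xs f≤g)

    fromℕ-Σℕ : (xs : List A) (f : A → ℕ) → fromℕ (Σℕ xs f) ≡ Σℚ xs (fromℕ ∘ f)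
    fromℕ-Σℕ []       f = refl
    fromℕ-Σℕ (x ∷ xs) f = trans (fromℕ-+ (f x) (Σℕ xs f)) (cong (fromℕ (f x) +_) (fromℕ-Σℕ xs f))

    count-false : (xs : List A) → count xs (λ _ → false) ≡ 0
    count-false []       = refl
    count-false (x ∷ xs) = count-false xs

    count-mono-≤ : (xs : List A) {p q : A → Bool} → (∀ x → p x ≡ true → q x ≡ true) → count xs p ℕ.≤ count xs q
    count-mono-≤ xs {p} {q} p⇒q = Σℕ-mono-≤ xs (λ x → 𝟙-mono-≤ (p x) (q x) (p⇒q x))

    count-< : (xs : List A) {p q : A → Bool} (x : A) → x ∈ xs → q x ≡ true → p x ≡ false →
              (∀ y → p y ≡ true → q y ≡ true) → count xs p ℕ.< count xs q
    count-< (y ∷ xs) x (here refl) qx px p⇒q rewrite qx | px = s≤s (count-mono-≤ xs p⇒q)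
    count-< (y ∷ xs) {p} {q} x (there x∈xs) qx px p⇒q = begin
      suc (𝟙 (p y) ℕ.+ count xs p)   ≡⟨ ℕ.+-suc (𝟙 (p y)) (count xs p) ⟨
      𝟙 (p y) ℕ.+ suc (count xs p)   ≤⟨ ℕ.+-mono-≤ (𝟙-mono-≤ (p y) (q y) (p⇒q y)) (count-< xs x x∈xs qx px p⇒q) ⟩
      𝟙 (q y) ℕ.+ count xs q         ∎
      where open ℕ.≤-Reasoning

    count-∨ : (xs : List A) (p q : A → Bool) → count xs (λ x → p x ∨ q x) ℕ.≤ count xs p ℕ.+ count xs q
    count-∨ []       p q = z≤n
    count-∨ (x ∷ xs) p q = ℕ.≤-trans (ℕ.+-mono-≤ (𝟙-∨ (p x) (q x)) (count-∨ xs p q))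
      (ℕ.≤-reflexive (ℕ-+-interchange (𝟙 (p x)) (𝟙 (q x)) (count xs p) (count xs q)))

    count-∧ˡ-≤ : (xs : List A) (b : Bool) (p : A → Bool) {m : ℕ} → count xs p ℕ.≤ m →
                 count xs (λ x → b ∧ p x) ℕ.≤ (if b then m else 0)
    count-∧ˡ-≤ xs true  p p≤m = p≤m
    count-∧ˡ-≤ xs false p p≤m = ℕ.≤-reflexive (count-false xs)

    Σℚ-if : (xs : List A) (p : A → Bool) (a : ℚ) → Σℚ xs (λ x → if p x then a else 0ℚ) ≡ a * fromℕ (count xs p)
    Σℚ-if []       p a = sym (*-zeroʳ a)
    Σℚ-if (x ∷ xs) p a with p x
    ... | false = trans (+-identityˡ _) (Σℚ-if xs p a)
    ... | true  = begin
      a + Σℚ xs (λ x → if p x then a else 0ℚ)   ≡⟨ cong (a +_) (Σℚ-if xs p a) ⟩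
      a + a * fromℕ (count xs p)                ≡⟨ cong (_+ a * fromℕ (count xs p)) (*-identityʳ a) ⟨
      a * 1ℚ + a * fromℕ (count xs p)           ≡⟨ *-distribˡ-+ a 1ℚ _ ⟨
      a * (1ℚ + fromℕ (count xs p))             ≡⟨ cong (a *_) (fromℕ-suc (count xs p)) ⟨
      a * fromℕ (suc (count xs p))              ∎
      where open ≡-Reasoning

  suc-≟-suc : ∀ {m} (x y : Fin m) → ⌊ suc x ≟ suc y ⌋ ≡ ⌊ x ≟ y ⌋
  suc-≟-suc x y with x ≟ y
  ... | yes _ = refl
  ... | no _  = refl

  count-≟ : ∀ m (l : Fin m) → count (allFin m) (λ w → ⌊ w ≟ l ⌋) ≡ 1
  count-≟ (suc m) zero    = trans (cong (foldr ℕ._+_ 0) (map-allFin-suc m (λ w → 𝟙 ⌊ w ≟ zero ⌋)))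
                                  (cong suc (count-false (allFin m)))
  count-≟ (suc m) (suc l) = trans (cong (foldr ℕ._+_ 0) (map-allFin-suc m (λ w → 𝟙 ⌊ w ≟ suc l ⌋)))
                                  (trans (Σℕ-cong (allFin m) (λ w → cong 𝟙 (suc-≟-suc w l))) (count-≟ m l))

  Σℚ-point : ∀ m (l : Fin m) (f : Fin m → ℚ) → Σℚ (allFin m) (λ y → f y * (if ⌊ y ≟ l ⌋ then 1ℚ else 0ℚ)) ≡ f l
  Σℚ-point (suc m) zero f = begin
    Σℚ (allFin (suc m)) (λ y → f y * (if ⌊ y ≟ zero ⌋ then 1ℚ else 0ℚ))
      ≡⟨ cong (foldr _+_ 0ℚ) (map-allFin-suc m (λ y → f y * (if ⌊ y ≟ zero ⌋ then 1ℚ else 0ℚ))) ⟩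
    f zero * 1ℚ + Σℚ (allFin m) (λ y → f (suc y) * 0ℚ)
      ≡⟨ cong₂ _+_ (*-identityʳ (f zero)) (trans (Σℚ-cong (allFin m) (λ y → *-zeroʳ (f (suc y)))) (Σℚ-0 (allFin m))) ⟩
    f zero + 0ℚ
      ≡⟨ +-identityʳ (f zero) ⟩
    f zero ∎
    where open ≡-Reasoning
  Σℚ-point (suc m) (suc l) f = begin
    Σℚ (allFin (suc m)) (λ y → f y * (if ⌊ y ≟ suc l ⌋ then 1ℚ else 0ℚ))
      ≡⟨ cong (foldr _+_ 0ℚ) (map-allFin-suc m (λ y → f y * (if ⌊ y ≟ suc l ⌋ then 1ℚ else 0ℚ))) ⟩
    f zero * 0ℚ + Σℚ (allFin m) (λ y → f (suc y) * (if ⌊ suc y ≟ suc l ⌋ then 1ℚ else 0ℚ))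
      ≡⟨ cong (f zero * 0ℚ +_) (Σℚ-cong (allFin m) (λ y →
           cong (λ b → f (suc y) * (if b then 1ℚ else 0ℚ)) (suc-≟-suc y l))) ⟩
    f zero * 0ℚ + Σℚ (allFin m) (λ y → f (suc y) * (if ⌊ y ≟ l ⌋ then 1ℚ else 0ℚ))
      ≡⟨ cong₂ _+_ (*-zeroʳ (f zero)) (Σℚ-point m l (f ∘ suc)) ⟩
    0ℚ + f (suc l)
      ≡⟨ +-identityˡ (f (suc l)) ⟩
    f (suc l) ∎
    where open ≡-Reasoning

  module _ {A : Set} where

    any-intro : (xs : List A) {p : A → Bool} (x : A) → x ∈ xs → p x ≡ true → any p xs ≡ true
    any-intro (y ∷ xs)     x (here refl)  px = ∨-introˡ _ px
    any-intro (y ∷ xs) {p} x (there x∈xs) px = ∨-introʳ (p y) (any-intro xs x x∈xs px)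

    any-elim : (xs : List A) (p : A → Bool) → any p xs ≡ true → Σ[ x ∈ A ] p x ≡ true
    any-elim (y ∷ xs) p any≡true with ∨-elim (p y) any≡true
    ... | inj₁ py = y , py
    ... | inj₂ rest = any-elim xs p rest

    count-any-≤ : {B : Set} (ys : List B) (xs : List A) (P : A → B → Bool) →
                  count ys (λ y → any (λ x → P x y) xs) ℕ.≤ Σℕ xs (λ x → count ys (P x))
    count-any-≤ ys []       P = ℕ.≤-reflexive (count-false ys)
    count-any-≤ ys (x ∷ xs) P = ℕ.≤-trans (count-∨ ys (P x) _) (ℕ.+-monoʳ-≤ (count ys (P x)) (count-any-≤ ys xs P))

  any-allFin-mono : ∀ {n} {p q : Fin n → Bool} → (∀ u → p u ≡ true → q u ≡ true) →
                    any p (allFin n) ≡ true → any q (allFin n) ≡ true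
  any-allFin-mono {n} {p} p⇒q any-p with any-elim (allFin n) p any-p
  ... | u , pu = any-intro (allFin n) u (∈-allFin u) (p⇒q u pu)

  module ProductExpectation {M : Set} (outcomes : List M) where

    average-of-constant : {p f : M → ℚ} {a : ℚ} → Σℚ outcomes p ≡ 1ℚ → (∀ x → f x ≡ a) →
                          Σℚ outcomes (λ x → p x * f x) ≡ a
    average-of-constant {p} {f} {a} Σp≡1 f≡a = begin
      Σℚ outcomes (λ x → p x * f x)   ≡⟨ Σℚ-cong outcomes (λ x → cong (p x *_) (f≡a x)) ⟩
      Σℚ outcomes (λ x → p x * a)     ≡⟨ Σℚ-*ʳ outcomes a p ⟩
      Σℚ outcomes p * a               ≡⟨ cong (_* a) Σp≡1 ⟩
      1ℚ * a                          ≡⟨ *-identityˡ a ⟩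
      a                               ∎
      where open ≡-Reasoning

    -- 𝔼 k q F is the expectation of F when the k coordinates are independent and
    -- coordinate i takes the value x with probability q i x.
    𝔼 : (k : ℕ) → (Fin k → M → ℚ) → (Vec M k → ℚ) → ℚ
    𝔼 zero    q F = F []ᵥ
    𝔼 (suc k) q F = Σℚ outcomes (λ x → q zero x * 𝔼 k (q ∘ suc) (λ c → F (x ∷ᵥ c)))

    𝔼-cong : ∀ k q {F G : Vec M k → ℚ} → (∀ c → F c ≡ G c) → 𝔼 k q F ≡ 𝔼 k q G
    𝔼-cong zero    q F≗G = F≗G []ᵥ
    𝔼-cong (suc k) q F≗G = Σℚ-cong outcomes (λ x → cong (q zero x *_) (𝔼-cong k (q ∘ suc) (λ c → F≗G (x ∷ᵥ c))))

    𝔼-+ : ∀ k q (F G : Vec M k → ℚ) → 𝔼 k q (λ c → F c + G c) ≡ 𝔼 k q F + 𝔼 k q G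
    𝔼-+ zero    q F G = refl
    𝔼-+ (suc k) q F G = trans
      (Σℚ-cong outcomes (λ x → trans (cong (q zero x *_) (𝔼-+ k (q ∘ suc) _ _)) (*-distribˡ-+ (q zero x) _ _)))
      (Σℚ-+ outcomes _ _)

    𝔼-*ˡ : ∀ k q (a : ℚ) (F : Vec M k → ℚ) → 𝔼 k q (λ c → a * F c) ≡ a * 𝔼 k q F
    𝔼-*ˡ zero    q a F = refl
    𝔼-*ˡ (suc k) q a F = trans
      (Σℚ-cong outcomes (λ x → trans (cong (q zero x *_) (𝔼-*ˡ k (q ∘ suc) a _)) (*-leftSwap (q zero x) a _)))
      (Σℚ-*ˡ outcomes a _)

    Normalised : ∀ {k} → (Fin k → M → ℚ) → Set
    Normalised q = ∀ i → Σℚ outcomes (q i) ≡ 1ℚ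

    𝔼-const : ∀ k q → Normalised q → (a : ℚ) → 𝔼 k q (λ _ → a) ≡ a
    𝔼-const zero    q Σq≡1 a = refl
    𝔼-const (suc k) q Σq≡1 a = average-of-constant (Σq≡1 zero) (λ x → 𝔼-const k (q ∘ suc) (Σq≡1 ∘ suc) a)

    𝔼-fromℕ-suc : ∀ k q → Normalised q → (F : Vec M k → ℕ) →
                  𝔼 k q (λ c → fromℕ (suc (F c))) ≡ 1ℚ + 𝔼 k q (λ c → fromℕ (F c))
    𝔼-fromℕ-suc k q Σq≡1 F = begin
      𝔼 k q (λ c → fromℕ (suc (F c)))                 ≡⟨ 𝔼-cong k q (λ c → fromℕ-suc (F c)) ⟩
      𝔼 k q (λ c → 1ℚ + fromℕ (F c))                  ≡⟨ 𝔼-+ k q (λ _ → 1ℚ) (λ c → fromℕ (F c)) ⟩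
      𝔼 k q (λ _ → 1ℚ) + 𝔼 k q (λ c → fromℕ (F c))    ≡⟨ cong (_+ 𝔼 k q (λ c → fromℕ (F c))) (𝔼-const k q Σq≡1 1ℚ) ⟩
      1ℚ + 𝔼 k q (λ c → fromℕ (F c))                  ∎
      where open ≡-Reasoning

    𝔼-Σℚ : ∀ k q → Normalised q → {A : Set} (xs : List A) (F : A → Vec M k → ℚ) →
           𝔼 k q (λ c → Σℚ xs (λ a → F a c)) ≡ Σℚ xs (λ a → 𝔼 k q (F a))
    𝔼-Σℚ k q Σq≡1 []       F = 𝔼-const k q Σq≡1 0ℚ
    𝔼-Σℚ k q Σq≡1 (a ∷ xs) F = trans (𝔼-+ k q (F a) _) (cong (𝔼 k q (F a) +_) (𝔼-Σℚ k q Σq≡1 xs F))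

    𝔼-mono-≤ : ∀ k q → (∀ i x → 0ℚ ≤ q i x) → {F G : Vec M k → ℚ} → (∀ c → F c ≤ G c) → 𝔼 k q F ≤ 𝔼 k q G
    𝔼-mono-≤ zero    q q≥0 F≤G = F≤G []ᵥ
    𝔼-mono-≤ (suc k) q q≥0 F≤G = Σℚ-mono-≤ outcomes (λ x →
      *-monoˡ-≤-nonNeg (q zero x) {{nonNegative (q≥0 zero x)}}
                       (𝔼-mono-≤ k (q ∘ suc) (q≥0 ∘ suc) (λ c → F≤G (x ∷ᵥ c))))

    𝔼-independent : ∀ k q → Normalised q → (u : Fin k) (h : M → ℚ) (G : Vec M k → ℚ) →
                    (∀ c x → G (c [ u ]≔ x) ≡ G c) →
                    𝔼 k q (λ c → h (lookup c u) * G c) ≡ Σℚ outcomes (λ x → q u x * h x) * 𝔼 k q G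
    𝔼-independent (suc k) q Σq≡1 zero h G G-ignores-u = begin
      Σℚ outcomes (λ x → q zero x * 𝔼 k (q ∘ suc) (λ c → h x * G (x ∷ᵥ c)))
        ≡⟨ Σℚ-cong outcomes (λ x → cong (q zero x *_)
             (trans (𝔼-*ˡ k (q ∘ suc) (h x) _) (cong (h x *_) (section≡𝔼 x)))) ⟩
      Σℚ outcomes (λ x → q zero x * (h x * 𝔼 (suc k) q G))
        ≡⟨ Σℚ-cong outcomes (λ x → sym (*-assoc (q zero x) (h x) _)) ⟩
      Σℚ outcomes (λ x → q zero x * h x * 𝔼 (suc k) q G)
        ≡⟨ Σℚ-*ʳ outcomes _ (λ x → q zero x * h x) ⟩
      Σℚ outcomes (λ x → q zero x * h x) * 𝔼 (suc k) q G ∎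
      where
      open ≡-Reasoning
      section : M → ℚ
      section x = 𝔼 k (q ∘ suc) (λ c → G (x ∷ᵥ c))
      section≡𝔼 : ∀ x → section x ≡ 𝔼 (suc k) q G
      section≡𝔼 x = sym (average-of-constant (Σq≡1 zero)
                      (λ y → 𝔼-cong k (q ∘ suc) (λ c → sym (G-ignores-u (y ∷ᵥ c) x))))
    𝔼-independent (suc k) q Σq≡1 (suc u) h G G-ignores-u = trans
      (Σℚ-cong outcomes (λ x → trans
        (cong (q zero x *_)
          (𝔼-independent k (q ∘ suc) (Σq≡1 ∘ suc) u h (λ c → G (x ∷ᵥ c)) (λ c → G-ignores-u (x ∷ᵥ c))))
        (*-leftSwap (q zero x) S _)))
      (Σℚ-*ˡ outcomes S _)
      where
      S = Σℚ outcomes (λ x → q (suc u) x * h x)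

    productWeight : (k : ℕ) → (Fin k → M → ℚ) → Vec M k → ℚ
    productWeight k q c = foldr _*_ 1ℚ (map (λ i → q i (lookup c i)) (allFin k))

    productWeight-∷ : ∀ k q x c → productWeight (suc k) q (x ∷ᵥ c) ≡ q zero x * productWeight k (q ∘ suc) c
    productWeight-∷ k q x c = cong (foldr _*_ 1ℚ) (map-allFin-suc k (λ i → q i (lookup (x ∷ᵥ c) i)))

    Σ-allVecs≡𝔼 : ∀ {n} (G : Graph n) k q (F : Vec M k → ℚ) →
                  Σℚ (allVecs G outcomes k) (λ c → productWeight k q c * F c) ≡ 𝔼 k q F
    Σ-allVecs≡𝔼 G zero    q F = trans (+-identityʳ _) (*-identityˡ _)
    Σ-allVecs≡𝔼 G (suc k) q F = begin
      Σℚ (allVecs G outcomes (suc k)) (λ c → productWeight (suc k) q c * F c)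
        ≡⟨ Σℚ-concatMap outcomes (λ x → map (x ∷ᵥ_) (allVecs G outcomes k)) _ ⟩
      Σℚ outcomes (λ x → Σℚ (map (x ∷ᵥ_) (allVecs G outcomes k)) (λ c → productWeight (suc k) q c * F c))
        ≡⟨ Σℚ-cong outcomes (λ x → trans (Σℚ-map (allVecs G outcomes k) (x ∷ᵥ_) _)
             (Σℚ-cong (allVecs G outcomes k) (λ c →
               trans (cong (_* F (x ∷ᵥ c)) (productWeight-∷ k q x c)) (*-assoc (q zero x) _ _)))) ⟩
      Σℚ outcomes (λ x → Σℚ (allVecs G outcomes k) (λ c → q zero x * (productWeight k (q ∘ suc) c * F (x ∷ᵥ c))))
        ≡⟨ Σℚ-cong outcomes (λ x → trans (Σℚ-*ˡ (allVecs G outcomes k) (q zero x) _)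
             (cong (q zero x *_) (Σ-allVecs≡𝔼 G k (q ∘ suc) (λ c → F (x ∷ᵥ c))))) ⟩
      𝔼 (suc k) q F ∎
      where open ≡-Reasoning

  choices : (n : ℕ) → List (Maybe (Fin n))
  choices n = nothing ∷ map just (allFin n)

  Σℚ-choices : ∀ {n} (f : Maybe (Fin n) → ℚ) → Σℚ (choices n) f ≡ f nothing + Σℚ (allFin n) (f ∘ just)
  Σℚ-choices {n} f = cong (f nothing +_) (Σℚ-map (allFin n) just f)

  module ChoiceDistribution {n : ℕ} (G : Graph n) (ϑ : Fin n → ℚ) where

    open ProductExpectation (choices n) using (Normalised)

    q : Fin n → Maybe (Fin n) → ℚ
    q = choiceProb G ϑ

    degree-view : ∀ w → deg G w ≡ 0 ⊎ Σ[ d ∈ ℕ ] deg G w ≡ suc d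
    degree-view w with deg G w
    ... | zero  = inj₁ refl
    ... | suc d = inj₂ (d , refl)

    q-isolated-nothing : ∀ {w} → deg G w ≡ 0 → q w nothing ≡ 1ℚ
    q-isolated-nothing {w} deg≡0 with deg G w
    q-isolated-nothing refl | .0 = refl

    q-isolated-just : ∀ {w} u → deg G w ≡ 0 → q w (just u) ≡ 0ℚ
    q-isolated-just {w} u deg≡0 with deg G w
    q-isolated-just u refl | .0 = refl

    q-nothing : ∀ {w d} → deg G w ≡ suc d → q w nothing ≡ 1ℚ - ϑ w
    q-nothing {w} deg≡1+d with deg G w
    q-nothing refl | ._ = refl

    q-just : ∀ {w d} u → deg G w ≡ suc d → q w (just u) ≡ (if adj G u w then ϑ w * (ℤ.+ 1 / suc d) else 0ℚ)
    q-just {w} u deg≡1+d with deg G w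
    q-just u refl | ._ = refl

    Σ-q-just : ∀ {w d} → deg G w ≡ suc d → Σℚ (allFin n) (q w ∘ just) ≡ ϑ w
    Σ-q-just {w} {d} deg≡1+d = begin
      Σℚ (allFin n) (q w ∘ just)                          ≡⟨ Σℚ-cong (allFin n) (λ u → q-just u deg≡1+d) ⟩
      Σℚ (allFin n) (λ u → if adj G u w then p else 0ℚ)   ≡⟨ Σℚ-if (allFin n) (λ u → adj G u w) p ⟩
      p * fromℕ (count (allFin n) (λ u → adj G u w))      ≡⟨ cong (λ m → p * fromℕ m) in-degree ⟩
      ϑ w * (ℤ.+ 1 / suc d) * fromℕ (suc d)               ≡⟨ *-assoc (ϑ w) _ _ ⟩
      ϑ w * ((ℤ.+ 1 / suc d) * fromℕ (suc d))             ≡⟨ cong (ϑ w *_) (1/n*n≡1 d) ⟩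
      ϑ w * 1ℚ                                            ≡⟨ *-identityʳ (ϑ w) ⟩
      ϑ w                                                 ∎
      where
      open ≡-Reasoning
      p = ϑ w * (ℤ.+ 1 / suc d)
      in-degree : count (allFin n) (λ u → adj G u w) ≡ suc d
      in-degree = trans (Σℕ-cong (allFin n) (λ u → cong 𝟙 (adj-sym G u w))) deg≡1+d

    q-normalised : Normalised {n} q
    q-normalised w with degree-view w
    ... | inj₁ deg≡0 = begin
      Σℚ (choices n) (q w)                        ≡⟨ Σℚ-choices (q w) ⟩
      q w nothing + Σℚ (allFin n) (q w ∘ just)    ≡⟨ cong₂ _+_ (q-isolated-nothing deg≡0) Σ-q-just-isolated ⟩
      1ℚ + 0ℚ                                     ≡⟨ +-identityʳ 1ℚ ⟩
      1ℚ                                          ∎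
      where
      open ≡-Reasoning
      Σ-q-just-isolated : Σℚ (allFin n) (q w ∘ just) ≡ 0ℚ
      Σ-q-just-isolated = trans (Σℚ-cong (allFin n) (λ u → q-isolated-just u deg≡0)) (Σℚ-0 (allFin n))
    ... | inj₂ (d , deg≡1+d) = begin
      Σℚ (choices n) (q w)                        ≡⟨ Σℚ-choices (q w) ⟩
      q w nothing + Σℚ (allFin n) (q w ∘ just)    ≡⟨ cong₂ _+_ (q-nothing deg≡1+d) (Σ-q-just deg≡1+d) ⟩
      1ℚ - ϑ w + ϑ w                              ≡⟨ p-q+q≡p (ϑ w) 1ℚ ⟩
      1ℚ                                          ∎
      where open ≡-Reasoning

    q-non-neighbour : ∀ {l u} → adj G l u ≡ false → q u (just l) ≡ 0ℚ
    q-non-neighbour {l} {u} ¬l~u with degree-view u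
    ... | inj₁ deg≡0       = q-isolated-just l deg≡0
    ... | inj₂ (d , deg≡1+d) = trans (q-just l deg≡1+d) (cong (λ b → if b then ϑ u * (ℤ.+ 1 / suc d) else 0ℚ) ¬l~u)

    module _ (ϑ∈[0,1] : ∀ w → (0ℚ ≤ ϑ w) × (ϑ w ≤ 1ℚ)) where

      ϑ/n-nonNeg : ∀ w d → 0ℚ ≤ ϑ w * (ℤ.+ 1 / suc d)
      ϑ/n-nonNeg w d = nonNegative⁻¹ _ {{nonNeg*nonNeg⇒nonNeg (ϑ w) {{nonNegative (proj₁ (ϑ∈[0,1] w))}}
                                                               (ℤ.+ 1 / suc d) {{normalize-nonNeg 1 (suc d)}}}}

      q-nonNeg : ∀ w x → 0ℚ ≤ q w x
      q-nonNeg w x with degree-view w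
      q-nonNeg w nothing  | inj₁ deg≡0 = subst (0ℚ ≤_) (sym (q-isolated-nothing deg≡0)) (nonNegative⁻¹ 1ℚ)
      q-nonNeg w (just u) | inj₁ deg≡0 = ≤-reflexive (sym (q-isolated-just u deg≡0))
      q-nonNeg w nothing  | inj₂ (d , deg≡1+d) = subst (0ℚ ≤_) (sym (q-nothing deg≡1+d)) 1-ϑ-nonNeg
        where
        1-ϑ-nonNeg : 0ℚ ≤ 1ℚ - ϑ w
        1-ϑ-nonNeg = subst (_≤ 1ℚ - ϑ w) (+-inverseʳ (ϑ w)) (+-monoˡ-≤ (- ϑ w) (proj₂ (ϑ∈[0,1] w)))
      q-nonNeg w (just u) | inj₂ (d , deg≡1+d) with adj G u w in u~w
      ... | true  = subst (0ℚ ≤_) (sym (trans (q-just u deg≡1+d) (cong (λ b → if b then _ else 0ℚ) u~w)))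
                          (ϑ/n-nonNeg w d)
      ... | false = ≤-reflexive (sym (q-non-neighbour u~w))

      q-just-*-≤-1 : ∀ l u {m} → m ℕ.≤ deg G u → q u (just l) * fromℕ m ≤ 1ℚ
      q-just-*-≤-1 l u {m} m≤deg with adj G l u in l~u | degree-view u
      ... | false | _                  = p≡0⇒p*q≤1 (fromℕ m) (q-non-neighbour l~u)
      ... | true  | inj₁ deg≡0         = p≡0⇒p*q≤1 (fromℕ m) (q-isolated-just l deg≡0)
      ... | true  | inj₂ (d , deg≡1+d) = begin
        q u (just l) * fromℕ m
          ≡⟨ cong (_* fromℕ m) (trans (q-just l deg≡1+d) (cong (λ b → if b then p else 0ℚ) l~u)) ⟩
        p * fromℕ m
          ≤⟨ *-monoˡ-≤-nonNeg p {{nonNegative (ϑ/n-nonNeg u d)}}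
                              (fromℕ-mono-≤ (ℕ.≤-trans m≤deg (ℕ.≤-reflexive deg≡1+d))) ⟩
        p * fromℕ (suc d)                          ≡⟨ *-assoc (ϑ u) _ _ ⟩
        ϑ u * ((ℤ.+ 1 / suc d) * fromℕ (suc d))    ≡⟨ cong (ϑ u *_) (1/n*n≡1 d) ⟩
        ϑ u * 1ℚ                                   ≡⟨ *-identityʳ (ϑ u) ⟩
        ϑ u                                        ≤⟨ proj₂ (ϑ∈[0,1] u) ⟩
        1ℚ                                         ∎
        where
        open ≤-Reasoning
        p = ϑ u * (ℤ.+ 1 / suc d)

  module LivePaths {n : ℕ} where

    Parents : Set
    Parents = Vec (Maybe (Fin n)) n

    _∈ᵇ_ : Fin n → List (Fin n) → Bool
    u ∈ᵇ []       = false
    u ∈ᵇ (w ∷ ws) = ⌊ u ≟ w ⌋ ∨ (u ∈ᵇ ws)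

    isParent : Maybe (Fin n) → Fin n → Bool
    isParent nothing  l = false
    isParent (just x) l = ⌊ x ≟ l ⌋

    freshChild : Parents → Fin n → List (Fin n) → Fin n → Bool
    freshChild c l V u = not (u ∈ᵇ (l ∷ V)) ∧ isParent (lookup c u) l

    -- Vertices reached from l by a live path of length ≤ k that never revisits l ∷ V.
    reachable : Parents → ℕ → Fin n → List (Fin n) → Fin n → Bool
    reachable c zero    l V w = ⌊ w ≟ l ⌋
    reachable c (suc k) l V w = ⌊ w ≟ l ⌋ ∨ any (λ u → freshChild c l V u ∧ reachable c k u (l ∷ V) w) (allFin n)

    pathCount : Parents → ℕ → Fin n → List (Fin n) → ℕ
    pathsVia  : Parents → ℕ → Fin n → List (Fin n) → Fin n → ℕ

    pathCount c zero    l V = 0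
    pathCount c (suc k) l V = Σℕ (allFin n) (pathsVia c k l V)

    pathsVia c k l V u = if freshChild c l V u then suc (pathCount c k u (l ∷ V)) else 0

    count-reachable-≤ : ∀ c k l V → count (allFin n) (reachable c k l V) ℕ.≤ suc (pathCount c k l V)
    count-reachable-≤ c zero    l V = ℕ.≤-reflexive (count-≟ n l)
    count-reachable-≤ c (suc k) l V = begin
      count (allFin n) (reachable c (suc k) l V)
        ≤⟨ count-∨ (allFin n) (λ w → ⌊ w ≟ l ⌋) _ ⟩
      count (allFin n) (λ w → ⌊ w ≟ l ⌋) ℕ.+ count (allFin n) (λ w → any (λ u → via u w) (allFin n))
        ≤⟨ ℕ.+-mono-≤ (ℕ.≤-reflexive (count-≟ n l)) (count-any-≤ (allFin n) (allFin n) via) ⟩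
      1 ℕ.+ Σℕ (allFin n) (λ u → count (allFin n) (via u))
        ≤⟨ ℕ.+-monoʳ-≤ 1 (Σℕ-mono-≤ (allFin n) (λ u →
             count-∧ˡ-≤ (allFin n) (freshChild c l V u) _ (count-reachable-≤ c k u (l ∷ V)))) ⟩
      suc (pathCount c (suc k) l V) ∎
      where
      open ℕ.≤-Reasoning
      via : Fin n → Fin n → Bool
      via u w = freshChild c l V u ∧ reachable c k u (l ∷ V) w

    reachable-root : ∀ c k l V w → ⌊ w ≟ l ⌋ ≡ true → reachable c k l V w ≡ true
    reachable-root c zero    l V w w≟l = w≟l
    reachable-root c (suc k) l V w w≟l = ∨-introˡ _ w≟l

    reachable-suc : ∀ c k l V w → reachable c k l V w ≡ true → reachable c (suc k) l V w ≡ true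
    reachable-suc c zero    l V w w≡l = ∨-introˡ _ w≡l
    reachable-suc c (suc k) l V w r with ∨-elim ⌊ w ≟ l ⌋ r
    ... | inj₁ w≡l = ∨-introˡ _ w≡l
    ... | inj₂ via = ∨-introʳ ⌊ w ≟ l ⌋ (any-allFin-mono (λ u fresh∧r →
      ∧-intro (∧-elimˡ (freshChild c l V u) fresh∧r)
              (reachable-suc c k u (l ∷ V) w (∧-elimʳ (freshChild c l V u) fresh∧r))) via)

    freshChild-intro : ∀ c l V u → u ∈ᵇ (l ∷ V) ≡ false → lookup c u ≡ just l → freshChild c l V u ≡ true
    freshChild-intro c l V u u∉ cu≡l rewrite u∉ | cu≡l = ≟-refl l

    reachable-via : ∀ c k l V u w → freshChild c l V u ≡ true → reachable c k u (l ∷ V) w ≡ true →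
                    reachable c (suc k) l V w ≡ true
    reachable-via c k l V u w fresh r = ∨-introʳ ⌊ w ≟ l ⌋ (any-intro (allFin n) u (∈-allFin u) (∧-intro fresh r))

    reachable-child : ∀ c k l V w → w ∈ᵇ (l ∷ V) ≡ false → lookup c w ≡ just l → reachable c (suc k) l V w ≡ true
    reachable-child c k l V w w∉ cw≡l =
      reachable-via c k l V w w (freshChild-intro c l V w w∉ cw≡l) (reachable-root c k w (l ∷ V) w (≟-refl w))

    reachable-step : ∀ c k l V x w → w ∈ᵇ (l ∷ V) ≡ false → reachable c k l V x ≡ true → lookup c w ≡ just x →
                     reachable c (suc k) l V w ≡ true
    reachable-step c zero    l V x w w∉ x≟l cw≡x =
      reachable-child c zero l V w w∉ (subst (λ y → lookup c w ≡ just y) (≟-sound x l x≟l) cw≡x)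
    reachable-step c (suc k) l V x w w∉ r cw≡x with ∨-elim ⌊ x ≟ l ⌋ r
    ... | inj₁ x≟l = reachable-child c (suc k) l V w w∉ (subst (λ y → lookup c w ≡ just y) (≟-sound x l x≟l) cw≡x)
    ... | inj₂ via with any-elim (allFin n) _ via
    ... | u , fresh∧r with ⌊ w ≟ u ⌋ in w≟u
    ...   | true  = reachable-via c (suc k) l V u w (∧-elimˡ (freshChild c l V u) fresh∧r)
                      (reachable-root c (suc k) u (l ∷ V) w w≟u)
    ...   | false = reachable-via c (suc k) l V u w (∧-elimˡ (freshChild c l V u) fresh∧r)
                      (reachable-step c k u (l ∷ V) x w (trans (cong (_∨ (w ∈ᵇ (l ∷ V))) w≟u) w∉)
                        (∧-elimʳ (freshChild c l V u) fresh∧r) cw≡x)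

    freshChild-update : ∀ c l V u x w → u ∈ᵇ (l ∷ V) ≡ true → freshChild (c [ u ]≔ x) l V w ≡ freshChild c l V w
    freshChild-update c l V u x w u∈ with w ∈ᵇ (l ∷ V) in w∈?
    ... | true  = refl
    ... | false = cong (λ y → isParent y l) (lookup∘update′ w≢u c x)
      where
      w≢u : w ≢ u
      w≢u refl with trans (sym u∈) w∈?
      ... | ()

    pathCount-update : ∀ c k l V u x → u ∈ᵇ (l ∷ V) ≡ true → pathCount (c [ u ]≔ x) k l V ≡ pathCount c k l V
    pathCount-update c zero    l V u x u∈ = refl
    pathCount-update c (suc k) l V u x u∈ = Σℕ-cong (allFin n) (λ w →
      cong₂ (λ b m → if b then suc m else 0) (freshChild-update c l V u x w u∈)
            (pathCount-update c k w (l ∷ V) u x (∨-introʳ ⌊ u ≟ w ⌋ u∈)))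

  module ExpectedPathCount {n : ℕ} (G : Graph n) (ϑ : Fin n → ℚ) (ϑ∈[0,1] : ∀ w → (0ℚ ≤ ϑ w) × (ϑ w ≤ 1ℚ)) where

    open LivePaths {n}
    open ProductExpectation (choices n)
    open ChoiceDistribution G ϑ

    freshNeighbours : Fin n → List (Fin n) → ℕ
    freshNeighbours l V = count (allFin n) (λ u → adj G l u ∧ not (u ∈ᵇ (l ∷ V)))

    -- The parent l is a neighbour of u that is never fresh.
    freshNeighbours-< : ∀ u l V → adj G l u ≡ true → freshNeighbours u (l ∷ V) ℕ.< deg G u
    freshNeighbours-< u l V l~u =
      count-< (allFin n) l (∈-allFin l) (trans (adj-sym G u l) l~u) l-visited (λ w → ∧-elimˡ (adj G u w))
      where
      l-visited : adj G u l ∧ not (l ∈ᵇ (u ∷ l ∷ V)) ≡ false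
      l-visited = trans (cong (λ b → adj G u l ∧ not b) (∨-introʳ ⌊ l ≟ u ⌋ (∨-introˡ _ (≟-refl l))))
                        (∧-zeroʳ (adj G u l))

    freshNeighbours-≤-deg : ∀ l V → freshNeighbours l V ℕ.≤ deg G l
    freshNeighbours-≤-deg l V = count-mono-≤ (allFin n) (λ u → ∧-elimˡ (adj G l u))

    q-just-*-fresh-≤ : ∀ u l V → q u (just l) * fromℕ (suc (freshNeighbours u (l ∷ V))) ≤ fromℕ (𝟙 (adj G l u))
    q-just-*-fresh-≤ u l V with adj G l u in l~u
    ... | true  = q-just-*-≤-1 ϑ∈[0,1] l u (freshNeighbours-< u l V l~u)
    ... | false = ≤-reflexive (trans (cong (_* fromℕ (suc (freshNeighbours u (l ∷ V)))) (q-non-neighbour l~u))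
                                     (*-zeroˡ (fromℕ (suc (freshNeighbours u (l ∷ V))))))

    Σ-q-isParent : ∀ u l → Σℚ (choices n) (λ x → q u x * (if isParent x l then 1ℚ else 0ℚ)) ≡ q u (just l)
    Σ-q-isParent u l = begin
      Σℚ (choices n) (λ x → q u x * (if isParent x l then 1ℚ else 0ℚ))
        ≡⟨ Σℚ-choices (λ x → q u x * (if isParent x l then 1ℚ else 0ℚ)) ⟩
      q u nothing * 0ℚ + Σℚ (allFin n) (λ y → q u (just y) * (if ⌊ y ≟ l ⌋ then 1ℚ else 0ℚ))
        ≡⟨ cong₂ _+_ (*-zeroʳ (q u nothing)) (Σℚ-point n l (q u ∘ just)) ⟩
      0ℚ + q u (just l)
        ≡⟨ +-identityˡ _ ⟩
      q u (just l) ∎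
      where open ≡-Reasoning

    𝔼-pathCount-≤ : ∀ k l V → 𝔼 n q (λ c → fromℕ (pathCount c k l V)) ≤ fromℕ (freshNeighbours l V)
    𝔼-pathsVia-≤  : ∀ k l V u → 𝔼 n q (λ c → fromℕ (pathsVia c k l V u)) ≤ fromℕ (𝟙 (adj G l u ∧ not (u ∈ᵇ (l ∷ V))))

    𝔼-pathCount-≤ zero    l V =
      ≤-trans (≤-reflexive (𝔼-const n q q-normalised 0ℚ)) (fromℕ-nonNeg (freshNeighbours l V))
    𝔼-pathCount-≤ (suc k) l V = begin
      𝔼 n q (λ c → fromℕ (Σℕ (allFin n) (pathsVia c k l V)))
        ≡⟨ 𝔼-cong n q (λ c → fromℕ-Σℕ (allFin n) (pathsVia c k l V)) ⟩
      𝔼 n q (λ c → Σℚ (allFin n) (λ u → fromℕ (pathsVia c k l V u)))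
        ≡⟨ 𝔼-Σℚ n q q-normalised (allFin n) (λ u c → fromℕ (pathsVia c k l V u)) ⟩
      Σℚ (allFin n) (λ u → 𝔼 n q (λ c → fromℕ (pathsVia c k l V u)))
        ≤⟨ Σℚ-mono-≤ (allFin n) (𝔼-pathsVia-≤ k l V) ⟩
      Σℚ (allFin n) (λ u → fromℕ (𝟙 (adj G l u ∧ not (u ∈ᵇ (l ∷ V)))))
        ≡⟨ fromℕ-Σℕ (allFin n) (λ u → 𝟙 (adj G l u ∧ not (u ∈ᵇ (l ∷ V)))) ⟨
      fromℕ (freshNeighbours l V) ∎
      where open ≤-Reasoning

    𝔼-pathsVia-≤ k l V u with u ∈ᵇ (l ∷ V) in u∈?
    ... | true  = ≤-trans (≤-reflexive (𝔼-const n q q-normalised 0ℚ)) (fromℕ-nonNeg (𝟙 (adj G l u ∧ false)))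
    ... | false = begin
      𝔼 n q (λ c → fromℕ (if isParent (lookup c u) l then suc (pathCount c k u (l ∷ V)) else 0))
        ≡⟨ 𝔼-cong n q (λ c → fromℕ-if (isParent (lookup c u) l) _) ⟩
      𝔼 n q (λ c → h (lookup c u) * fromℕ (suc (pathCount c k u (l ∷ V))))
        ≡⟨ 𝔼-independent n q q-normalised u h (λ c → fromℕ (suc (pathCount c k u (l ∷ V)))) pathCount-ignores-u ⟩
      Σℚ (choices n) (λ x → q u x * h x) * 𝔼 n q (λ c → fromℕ (suc (pathCount c k u (l ∷ V))))
        ≡⟨ cong₂ _*_ (Σ-q-isParent u l) (𝔼-fromℕ-suc n q q-normalised (λ c → pathCount c k u (l ∷ V))) ⟩
      q u (just l) * (1ℚ + 𝔼 n q (λ c → fromℕ (pathCount c k u (l ∷ V))))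
        ≤⟨ *-monoˡ-≤-nonNeg (q u (just l)) {{nonNegative (q-nonNeg ϑ∈[0,1] u (just l))}}
                            (+-monoʳ-≤ 1ℚ (𝔼-pathCount-≤ k u (l ∷ V))) ⟩
      q u (just l) * (1ℚ + fromℕ (freshNeighbours u (l ∷ V)))
        ≡⟨ cong (q u (just l) *_) (fromℕ-suc (freshNeighbours u (l ∷ V))) ⟨
      q u (just l) * fromℕ (suc (freshNeighbours u (l ∷ V)))
        ≤⟨ q-just-*-fresh-≤ u l V ⟩
      fromℕ (𝟙 (adj G l u))
        ≡⟨ cong (fromℕ ∘ 𝟙) (∧-identityʳ (adj G l u)) ⟨
      fromℕ (𝟙 (adj G l u ∧ true)) ∎
      where
      open ≤-Reasoning
      h : Maybe (Fin n) → ℚ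
      h x = if isParent x l then 1ℚ else 0ℚ
      pathCount-ignores-u : ∀ c x → fromℕ (suc (pathCount (c [ u ]≔ x) k u (l ∷ V)))
                                  ≡ fromℕ (suc (pathCount c k u (l ∷ V)))
      pathCount-ignores-u c x = cong (fromℕ ∘ suc) (pathCount-update c k u (l ∷ V) u x (∨-introˡ _ (≟-refl u)))

  module _ {n : ℕ} (G : Graph n) where

    open LivePaths {n}

    iter-⊆-reachable : ∀ c v k w → iter G k c (singleton G v) w ≡ true → reachable c k v [] w ≡ true
    iter-⊆-reachable c v zero    w w≟v = w≟v
    iter-⊆-reachable c v (suc k) w infected with lookup c w in cw
    ... | nothing = reachable-suc c k v [] w (iter-⊆-reachable c v k w infected)
    ... | just x with ∨-elim (iter G k c (singleton G v) w) infected
    ...   | inj₁ w-infected = reachable-suc c k v [] w (iter-⊆-reachable c v k w w-infected)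
    ...   | inj₂ x-infected with w ∈ᵇ (v ∷ []) in w∈?
    ...     | false = reachable-step c k v [] x w w∈? (iter-⊆-reachable c v k x x-infected) cw
    ...     | true  = reachable-root c (suc k) v [] w (trans (sym (∨-identityʳ _)) w∈?)

    countTrue-infected-≤ : ∀ c v → countTrue G (infected G c (singleton G v)) ℕ.≤ suc (pathCount c n v [])
    countTrue-infected-≤ c v =
      ℕ.≤-trans (count-mono-≤ (allFin n) (iter-⊆-reachable c v n)) (count-reachable-≤ c n v [])

open import Data.Nat using (ℕ; suc; _+_)
open import Data.Fin using (Fin)
open import Data.Integer using (+_)
open import Data.Rational using (ℚ; 0ℚ; 1ℚ; _≤_; _/_)
import Data.Rational as ℚ
open import Data.Rational.Properties using (module ≤-Reasoning; +-monoʳ-≤; +-comm)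
open import Data.Product using (_×_)
open import Data.List using ([])
open import Relation.Binary.PropositionalEquality using (trans; sym)

lemma14 : (n : ℕ) (G : Graph n) → IsTree G → (ϑ : Fin n → ℚ) →
          (∀ w → (0ℚ ≤ ϑ w) × (ϑ w ≤ 1ℚ)) →
          (v : Fin n) → σ G ϑ (singleton G v) ≤ (+ (deg G v + 1)) / 1
lemma14 n G _ ϑ ϑ∈[0,1] v = begin
  σ G ϑ (singleton G v)
    ≡⟨ Σ-allVecs≡𝔼 G n q infectedCount ⟩
  𝔼 n q infectedCount
    ≤⟨ 𝔼-mono-≤ n q (q-nonNeg ϑ∈[0,1]) (λ c → fromℕ-mono-≤ (countTrue-infected-≤ G c v)) ⟩
  𝔼 n q (λ c → fromℕ (suc (pathCount c n v [])))
    ≡⟨ 𝔼-fromℕ-suc n q q-normalised (λ c → pathCount c n v []) ⟩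
  1ℚ ℚ.+ 𝔼 n q (λ c → fromℕ (pathCount c n v []))
    ≤⟨ +-monoʳ-≤ 1ℚ (𝔼-pathCount-≤ n v []) ⟩
  1ℚ ℚ.+ fromℕ (freshNeighbours v [])
    ≤⟨ +-monoʳ-≤ 1ℚ (fromℕ-mono-≤ (freshNeighbours-≤-deg v [])) ⟩
  1ℚ ℚ.+ fromℕ (deg G v)
    ≡⟨ trans (+-comm 1ℚ (fromℕ (deg G v))) (sym (fromℕ-+ (deg G v) 1)) ⟩
  fromℕ (deg G v + 1) ∎
  where
  open ProductExpectation (choices n)
  open ChoiceDistribution G ϑ
  open ExpectedPathCount G ϑ ϑ∈[0,1]
  open LivePaths
  open ≤-Reasoning
  infectedCount : Config G → ℚ
  infectedCount c = fromℕ (countTrue G (infected G c (singleton G v)))
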